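{- Let $q$ be a prime power, $n,k,r$ positive integers, $S$ a $(k-r)$-dimensional and $T$ an $r$-dimensional $\mathbb{F}_q$-subspace of $\mathbb{F}_{q^n}$ with $r\le k-r$, and $U=S\times T$. For a positive integer $i$ let $$\mathcal{I}_i(S,T)=\bigcup a_1^{ -1}S\cap\cdots\cap a_i^{ -1}S,$$ the union taken over all $a_1,\ldots,a_i\in T$ that are $\mathbb{F}_q$-linearly independent. Then the set of points of weight exactly $i$ in $L_U$, different from $\langle(1,0)\rangle_{\mathbb{F}_{q^n}}$, is $\{\langle(\xi,1)\rangle_{\mathbb{F}_{q^n}}:\xi\in\mathcal{I}_i(S,T)\setminus\mathcal{I}_{i+1}(S,T)\}$.
   Context: For an $\mathbb{F}_q$-subspace $U$ of $\mathbb{F}_{q^n}^2$, $L_U=\{\langle u\rangle_{\mathbb{F}_{q^n}}: u\in U\setminus\{0\}\}\subseteq\mathrm{PG}(1,q^n)$, and the weight of a point $\langle v\rangle_{\mathbb{F}_{q^n}}$ is $\dim_{\mathbb{F}_q}(U\cap\langle v\rangle_{\mathbb{F}_{q^n}})$. $S\times T=\{(s,t):s\in S,t\in T\}$; $a^{ -1}S=\{a^{ -1}s:s\in S\}$. -}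

module Defs where

open import Level using (Level; _⊔_)
open import Data.Nat using (ℕ; _^_; _≤_) renaming (zero to nzero; suc to nsuc)
open import Data.Nat.Primality using (Prime)
open import Data.Fin using (Fin) renaming (zero to fzero; suc to fsuc)
open import Data.Product using (Σ; ∃; ∃-syntax; _×_; _,_)
open import Data.Unit.Polymorphic using (⊤)
open import Relation.Nullary using (¬_)
open import Relation.Binary.PropositionalEquality using (_≡_)
open import Algebra.Bundles using (CommutativeRing)

IsPrimePower : ℕ → Set
IsPrimePower q = ∃[ p ] ∃[ m ] (Prime p × 1 ≤ m × q ≡ p ^ m)

module FieldDefs {c ℓ : Level} (R : CommutativeRing c ℓ) where
  open CommutativeRing R hiding (zero)

  L : Level
  L = c ⊔ ℓ

  IsField : Set L
  IsField = (¬ (1# ≈ 0#)) × (∀ x → ¬ (x ≈ 0#) → ∃[ y ] (x * y ≈ 1#))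

  HasCard : {A : Set c} (_≈A_ : A → A → Set ℓ) → (A → Set L) → ℕ → Set L
  HasCard {A} _≈A_ P m =
    Σ (Fin m → A) λ e →
      (∀ i → P (e i)) × (∀ i j → e i ≈A e j → i ≡ j) × (∀ x → P x → ∃[ i ] (x ≈A e i))

  IsSubfield : (Carrier → Set L) → Set L
  IsSubfield F =
    (∀ {x y} → x ≈ y → F x → F y) × F 0# × F 1#
    × (∀ {x y} → F x → F y → F (x + y)) × (∀ {x} → F x → F (- x))
    × (∀ {x y} → F x → F y → F (x * y))
    × (∀ {x y} → F x → x * y ≈ 1# → F y)

  module Vect {V : Set c} (_≈V_ : V → V → Set ℓ) (_+V_ : V → V → V) (0V : V)
              (_·V_ : Carrier → V → V) (F : Carrier → Set L) where

    lsum : {d : ℕ} → (Fin d → V) → V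
    lsum {nzero} f = 0V
    lsum {nsuc d} f = f fzero +V lsum (λ i → f (fsuc i))

    IsSubspace : (V → Set L) → Set L
    IsSubspace W = (∀ {x y} → x ≈V y → W x → W y) × W 0V
      × (∀ {x y} → W x → W y → W (x +V y)) × (∀ {a x} → F a → W x → W (a ·V x))

    Independent : {d : ℕ} → (Fin d → V) → Set L
    Independent {d} b = (cf : Fin d → Carrier) → (∀ i → F (cf i)) →
      lsum (λ i → cf i ·V b i) ≈V 0V → ∀ i → cf i ≈ 0#

    InSpan : {d : ℕ} → (Fin d → V) → V → Set L
    InSpan {d} b v = Σ (Fin d → Carrier) λ cf → (∀ i → F (cf i)) × (v ≈V lsum (λ i → cf i ·V b i))

    HasDim : (V → Set L) → ℕ → Set L
    HasDim W d = Σ (Fin d → V) λ b → (∀ i → W (b i)) × Independent b × (∀ v → W v → InSpan b v)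

  R² : Set c
  R² = Carrier × Carrier

  _≈₂_ : R² → R² → Set ℓ
  (a , b) ≈₂ (a' , b') = (a ≈ a') × (b ≈ b')

  _+₂_ : R² → R² → R²
  (a , b) +₂ (a' , b') = (a + a' , b + b')

  0₂ : R²
  0₂ = (0# , 0#)

  _·₂_ : Carrier → R² → R²
  λ' ·₂ (a , b) = (λ' * a , λ' * b)

  module V1 = Vect _≈_ _+_ 0# _*_
  module V2 = Vect _≈₂_ _+₂_ 0₂ _·₂_

  _×ˢ_ : (Carrier → Set L) → (Carrier → Set L) → R² → Set L
  (S ×ˢ T) (s , t) = S s × T t

  -- ⟨u⟩ = ⟨v⟩ as points of PG(1, K)
  SamePoint : R² → R² → Set L
  SamePoint u v = ∃[ μ ] (¬ (μ ≈ 0#) × u ≈₂ (μ ·₂ v))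

  InL : (R² → Set L) → R² → Set L
  InL U v = ∃[ u ] (U u × ¬ (u ≈₂ 0₂) × SamePoint u v)

  Meet : (R² → Set L) → R² → R² → Set L
  Meet U v u = U u × ∃[ μ ] (u ≈₂ (μ ·₂ v))

  HasWeight : (Carrier → Set L) → (R² → Set L) → R² → ℕ → Set L
  HasWeight F U v w = V2.HasDim F (Meet U v) w

  InInvScale : Carrier → (Carrier → Set L) → Carrier → Set L
  InInvScale a S ξ = ∃[ a⁻¹ ] (a * a⁻¹ ≈ 1# × ∃[ s ] (S s × ξ ≈ a⁻¹ * s))

  InI : (Carrier → Set L) → ℕ → (Carrier → Set L) → (Carrier → Set L) → Carrier → Set L
  InI F i S T ξ = Σ (Fin i → Carrier) λ a →
    (∀ j → T (a j)) × V1.Independent F a × (∀ j → InInvScale (a j) S ξ)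

-- A point ⟨v⟩ ≠ ⟨(1,0)⟩ of PG(1,K) is ⟨(ξ,1)⟩ with ξ = v₁/v₂, and U ∩ ⟨(ξ,1)⟩ is the graph
-- {(tξ, t)} over the F-space M_ξ = {t ∈ T : tξ ∈ S}, so the weight of ⟨(ξ,1)⟩ is dim M_ξ. On the other
-- hand ξ ∈ I_j(S,T) says exactly that M_ξ contains j independent vectors, and a space has dimension i
-- iff it contains i but not i + 1 independent vectors: one way is Steinitz, the other extends i
-- independent vectors by any vector outside their span, span membership being decidable because F and
-- K are finite.
module Submission where

open import Defs
open import Level using (Level)
open import Algebra.Bundles using (CommutativeRing)
open import Data.Nat using (ℕ; zero; suc; _^_; _≤_; _∸_; s≤s; z≤n)
open import Data.Fin using (Fin; zero; suc; punchIn)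
open import Data.Fin.Properties using (any?) renaming (_≟_ to _≟ᶠ_)
open import Data.Vec.Functional using (_∷_; removeAt)
open import Data.Product using (Σ; ∃-syntax; _×_; _,_; proj₁; proj₂)
open import Data.Unit.Polymorphic using (⊤)
open import Data.Empty using (⊥-elim)
open import Function using (_∘_)
open import Relation.Binary.Definitions using (Decidable; _Respects_)
open import Relation.Binary.PropositionalEquality using () renaming (refl to ≡-refl)
open import Relation.Nullary using (¬_; Dec; yes; no)
open import Relation.Nullary.Decidable using (¬?; decidable-stable)

all-∷ : ∀ {a p} {A : Set a} {P : A → Set p} {d} {x : A} {xs : Fin d → A} →
        P x → (∀ j → P (xs j)) → ∀ j → P ((x ∷ xs) j)
all-∷ px pxs zero    = px
all-∷ px pxs (suc j) = pxs j

module ProjectiveLine {c ℓ : Level} (K : CommutativeRing c ℓ) where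
  open CommutativeRing K hiding (zero)
  open FieldDefs K
  open import Algebra.Properties.Group +-group
    using (\\-leftDividesˡ; \\-leftDividesʳ; inverseʳ-unique; ⁻¹-involutive)
  open import Algebra.Properties.Ring ring using (-‿distribˡ-*; -‿distribʳ-*)
  open import Algebra.Properties.Semiring.Sum semiring
    using (sum; sum-cong-≋; sum-replicate-zero; sum-remove; ∑-distrib-+; *-distribˡ-sum; *-distribʳ-sum)
  open import Relation.Binary.Reasoning.Setoid setoid

  finite⇒≈-decidable : ∀ {m} → HasCard _≈_ (λ _ → ⊤) m → Decidable _≈_
  finite⇒≈-decidable (e , _ , e-injective , e-onto) x y with e-onto x _ | e-onto y _
  ... | i , x≈eᵢ | j , y≈eⱼ with i ≟ᶠ j
  ...   | yes ≡-refl = yes (trans x≈eᵢ (sym y≈eⱼ))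
  ...   | no i≢j   = no λ x≈y → i≢j (e-injective i j (trans (sym x≈eᵢ) (trans x≈y y≈eⱼ)))

  *-cancelˡ-by-inverse : ∀ {x x'} → x' * x ≈ 1# → ∀ y → x' * (x * y) ≈ y
  *-cancelˡ-by-inverse {x} {x'} x'x≈1 y = begin
    x' * (x * y) ≈⟨ *-assoc x' x y ⟨
    x' * x * y   ≈⟨ *-congʳ x'x≈1 ⟩
    1# * y       ≈⟨ *-identityˡ y ⟩
    y            ∎

  x+-[xp']p≈0 : ∀ {p p'} → p * p' ≈ 1# → ∀ x → x + - (x * p') * p ≈ 0#
  x+-[xp']p≈0 {p} {p'} pp'≈1 x = begin
    x + - (x * p') * p   ≈⟨ +-congˡ (-‿distribˡ-* (x * p') p) ⟨
    x + - (x * p' * p)   ≈⟨ +-congˡ (-‿cong (*-assoc x p' p)) ⟩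
    x + - (x * (p' * p)) ≈⟨ +-congˡ (-‿cong (*-congˡ (trans (*-comm p' p) pp'≈1))) ⟩
    x + - (x * 1#)       ≈⟨ +-congˡ (-‿cong (*-identityʳ x)) ⟩
    x - x                ≈⟨ -‿inverseʳ x ⟩
    0#                   ∎

  sum-zero : ∀ {d} {f : Fin d → Carrier} → (∀ j → f j ≈ 0#) → sum f ≈ 0#
  sum-zero {d} f≈0 = trans (sum-cong-≋ f≈0) (sum-replicate-zero d)

  Meet-resp-SamePoint : ∀ {U v w u} → SamePoint v w → Meet U v u → Meet U w u
  Meet-resp-SamePoint (μ , _ , v₁≈ , v₂≈) (u∈U , λ′ , u₁≈ , u₂≈) =
    u∈U , λ′ * μ ,
    trans u₁≈ (trans (*-congˡ v₁≈) (sym (*-assoc λ′ μ _))) ,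
    trans u₂≈ (trans (*-congˡ v₂≈) (sym (*-assoc λ′ μ _)))

  InInvScale⇒scaled : ∀ {S : Carrier → Set L} {a ξ} → S Respects _≈_ →
                      InInvScale a S ξ → S (a * ξ)
  InInvScale⇒scaled S-resp (a' , aa'≈1 , s , s∈S , ξ≈a's) =
    S-resp (sym (trans (*-congˡ ξ≈a's) (*-cancelˡ-by-inverse aa'≈1 s))) s∈S

  Multipliers : (Carrier → Set L) → (Carrier → Set L) → Carrier → Carrier → Set L
  Multipliers S T ξ t = T t × S (t * ξ)

  Graph : Carrier → (Carrier → Set L) → R² → Set L
  Graph ξ W (s , t) = W t × s ≈ t * ξ

  module OverField (isField : IsField) where

    1≉0 : ¬ 1# ≈ 0#
    1≉0 = proj₁ isField

    inverse : ∀ x → ¬ x ≈ 0# → ∃[ x' ] (x * x' ≈ 1#)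
    inverse = proj₂ isField

    SamePoint-sym : ∀ {u v} → SamePoint u v → SamePoint v u
    SamePoint-sym (μ , μ≉0 , u₁≈ , u₂≈) =
      μ' , μ'≉0 ,
      trans (sym (*-cancelˡ-by-inverse μ'μ≈1 _)) (*-congˡ (sym u₁≈)) ,
      trans (sym (*-cancelˡ-by-inverse μ'μ≈1 _)) (*-congˡ (sym u₂≈))
      where
        μ' = proj₁ (inverse μ μ≉0)
        μμ'≈1 = proj₂ (inverse μ μ≉0)
        μ'μ≈1 = trans (*-comm μ' μ) μμ'≈1
        μ'≉0 : ¬ μ' ≈ 0#
        μ'≉0 μ'≈0 = 1≉0 (trans (sym μμ'≈1) (trans (*-congˡ μ'≈0) (zeroʳ μ)))

    ¬∞⇒affine : ∀ {v} → ¬ v ≈₂ 0₂ → ¬ SamePoint v (1# , 0#) → ∃[ ξ ] SamePoint v (ξ , 1#)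
    ¬∞⇒affine {v₁ , v₂} v≉0 v≁∞ = v₁ * v₂' , v₂ , v₂≉0 , sym v₂[v₁v₂']≈v₁ , sym (*-identityʳ v₂)
      where
        v₂≉0 : ¬ v₂ ≈ 0#
        v₂≉0 v₂≈0 = v≁∞ (v₁ , (λ v₁≈0 → v≉0 (v₁≈0 , v₂≈0)) ,
                           sym (*-identityʳ v₁) , trans v₂≈0 (sym (zeroʳ v₁)))
        v₂' = proj₁ (inverse v₂ v₂≉0)
        v₂[v₁v₂']≈v₁ : v₂ * (v₁ * v₂') ≈ v₁
        v₂[v₁v₂']≈v₁ = trans (*-congˡ (*-comm v₁ v₂'))
                             (*-cancelˡ-by-inverse (proj₂ (inverse v₂ v₂≉0)) v₁)

    affine⇒¬∞ : ∀ {v ξ} → SamePoint v (ξ , 1#) → ¬ SamePoint v (1# , 0#)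
    affine⇒¬∞ (μ , μ≉0 , _ , v₂≈μ) (λ′ , _ , _ , v₂≈0) =
      μ≉0 (trans (sym (*-identityʳ μ)) (trans (sym v₂≈μ) (trans v₂≈0 (zeroʳ λ′))))

    scaled⇒InInvScale : ∀ {S : Carrier → Set L} {a ξ} → ¬ a ≈ 0# → S (a * ξ) → InInvScale a S ξ
    scaled⇒InInvScale {a = a} {ξ} a≉0 aξ∈S =
      a' , aa'≈1 , a * ξ , aξ∈S , sym (*-cancelˡ-by-inverse (trans (*-comm a' a) aa'≈1) ξ)
      where
        a' = proj₁ (inverse a a≉0)
        aa'≈1 = proj₂ (inverse a a≉0)

    meet⇒graph : ∀ {S T : Carrier → Set L} {v ξ u} → S Respects _≈_ → SamePoint v (ξ , 1#) →
                 Meet (S ×ˢ T) v u → Graph ξ (Multipliers S T ξ) u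
    meet⇒graph {S} {T} S-resp v∼ξ u∈meet with Meet-resp-SamePoint {S ×ˢ T} v∼ξ u∈meet
    ... | (s∈S , t∈T) , λ′ , s≈λ′ξ , t≈λ′1 = (t∈T , S-resp s≈tξ s∈S) , s≈tξ
      where s≈tξ = trans s≈λ′ξ (*-congʳ (sym (trans t≈λ′1 (*-identityʳ λ′))))

    graph⇒meet : ∀ {S T : Carrier → Set L} {v ξ u} → S Respects _≈_ → SamePoint v (ξ , 1#) →
                 Graph ξ (Multipliers S T ξ) u → Meet (S ×ˢ T) v u
    graph⇒meet {S} {T} {u = s , t} S-resp v∼ξ ((t∈T , tξ∈S) , s≈tξ) =
      Meet-resp-SamePoint {S ×ˢ T} (SamePoint-sym v∼ξ)
        ((S-resp (sym s≈tξ) tξ∈S , t∈T) , t , s≈tξ , sym (*-identityʳ t))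

    Meet-nonzero⇒InL : ∀ {U v u} → Meet U v u → ¬ u ≈₂ 0₂ → InL U v
    Meet-nonzero⇒InL {u = u} (u∈U , μ , u₁≈ , u₂≈) u≉0 = u , u∈U , u≉0 , μ , μ≉0 , u₁≈ , u₂≈
      where
        μ≉0 : ¬ μ ≈ 0#
        μ≉0 μ≈0 = u≉0 (trans u₁≈ (trans (*-congʳ μ≈0) (zeroˡ _)) ,
                       trans u₂≈ (trans (*-congʳ μ≈0) (zeroˡ _)))

    module OverSubfield (F : Carrier → Set L) (isSubfield : IsSubfield F) where
      open V1 F
      open V2 F using () renaming (lsum to lsum₂; Independent to Independent₂; HasDim to HasDim₂)

      F-0 : F 0#
      F-0 = proj₁ (proj₂ isSubfield)

      F-1 : F 1#
      F-1 = proj₁ (proj₂ (proj₂ isSubfield))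

      F-+ : ∀ {x y} → F x → F y → F (x + y)
      F-+ = proj₁ (proj₂ (proj₂ (proj₂ isSubfield)))

      F-neg : ∀ {x} → F x → F (- x)
      F-neg = proj₁ (proj₂ (proj₂ (proj₂ (proj₂ isSubfield))))

      F-* : ∀ {x y} → F x → F y → F (x * y)
      F-* = proj₁ (proj₂ (proj₂ (proj₂ (proj₂ (proj₂ isSubfield)))))

      F-inverse : ∀ {x y} → F x → x * y ≈ 1# → F y
      F-inverse = proj₂ (proj₂ (proj₂ (proj₂ (proj₂ (proj₂ isSubfield)))))

      F-sum : ∀ {d} {f : Fin d → Carrier} → (∀ j → F (f j)) → F (sum f)
      F-sum {zero}  f∈F = F-0
      F-sum {suc d} f∈F = F-+ (f∈F zero) (F-sum (f∈F ∘ suc))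

      lsum≈sum : ∀ {d} (f : Fin d → Carrier) → lsum f ≈ sum f
      lsum≈sum {zero}  f = refl
      lsum≈sum {suc d} f = +-congˡ (lsum≈sum (f ∘ suc))

      lsum-cong : ∀ {d} {f g : Fin d → Carrier} → (∀ j → f j ≈ g j) → lsum f ≈ lsum g
      lsum-cong {f = f} {g} f≈g = trans (lsum≈sum f) (trans (sum-cong-≋ f≈g) (sym (lsum≈sum g)))

      lsum-zero : ∀ {d} {f : Fin d → Carrier} → (∀ j → f j ≈ 0#) → lsum f ≈ 0#
      lsum-zero {f = f} f≈0 = trans (lsum≈sum f) (sum-zero f≈0)

      lsum-*ʳ-assoc : ∀ {d} (c b : Fin d → Carrier) ξ →
                      lsum (λ j → c j * (b j * ξ)) ≈ lsum (λ j → c j * b j) * ξ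
      lsum-*ʳ-assoc c b ξ = begin
        lsum (λ j → c j * (b j * ξ)) ≈⟨ lsum≈sum (λ j → c j * (b j * ξ)) ⟩
        sum (λ j → c j * (b j * ξ))  ≈⟨ sum-cong-≋ (λ j → *-assoc (c j) (b j) ξ) ⟨
        sum (λ j → c j * b j * ξ)    ≈⟨ *-distribʳ-sum ξ (λ j → c j * b j) ⟨
        sum (λ j → c j * b j) * ξ    ≈⟨ *-congʳ (lsum≈sum (λ j → c j * b j)) ⟨
        lsum (λ j → c j * b j) * ξ   ∎

      lsum₂-components : ∀ {d} (c : Fin d → Carrier) (u : Fin d → R²) →
        lsum₂ (λ j → c j ·₂ u j) ≈₂ (lsum (λ j → c j * proj₁ (u j)) , lsum (λ j → c j * proj₂ (u j)))
      lsum₂-components {zero}  c u = refl , refl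
      lsum₂-components {suc d} c u =
        +-congˡ (proj₁ (lsum₂-components (c ∘ suc) (u ∘ suc))) ,
        +-congˡ (proj₂ (lsum₂-components (c ∘ suc) (u ∘ suc)))

      δ : ∀ {d} → Fin d → Fin d → Carrier
      δ zero    zero    = 1#
      δ zero    (suc _) = 0#
      δ (suc _) zero    = 0#
      δ (suc j) (suc k) = δ j k

      δ∈F : ∀ {d} (j k : Fin d) → F (δ j k)
      δ∈F zero    zero    = F-1
      δ∈F zero    (suc _) = F-0
      δ∈F (suc _) zero    = F-0
      δ∈F (suc j) (suc k) = δ∈F j k

      δ-diag : ∀ {d} (j : Fin d) → δ j j ≈ 1#
      δ-diag zero    = refl
      δ-diag (suc j) = δ-diag j

      δ-vanishes : ∀ {d} (a : Fin d → Carrier) j → a j ≈ 0# → ∀ k → δ j k * a k ≈ 0#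
      δ-vanishes a zero    aⱼ≈0 zero    = trans (*-congˡ aⱼ≈0) (zeroʳ 1#)
      δ-vanishes a zero    aⱼ≈0 (suc k) = zeroˡ (a (suc k))
      δ-vanishes a (suc j) aⱼ≈0 zero    = zeroˡ (a zero)
      δ-vanishes a (suc j) aⱼ≈0 (suc k) = δ-vanishes (a ∘ suc) j aⱼ≈0 k

      independent⇒nonzero : ∀ {d} {a : Fin d → Carrier} → Independent a → ∀ j → ¬ a j ≈ 0#
      independent⇒nonzero {a = a} ia j aⱼ≈0 =
        1≉0 (trans (sym (δ-diag j)) (ia (δ j) (δ∈F j) (lsum-zero (δ-vanishes a j aⱼ≈0)) j))

      independent-shear : ∀ {d} {a : Fin (suc d) → Carrier} {r : Fin d → Carrier} →
                          (∀ i → F (r i)) → Independent a →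
                          Independent (λ i → a (suc i) + r i * a zero)
      independent-shear {a = a} {r} r∈F ia μ μ∈F rel i =
        ia (sum (λ i → μ i * r i) ∷ μ) (all-∷ {P = F} (F-sum (λ i → F-* (μ∈F i) (r∈F i))) μ∈F)
           rel′ (suc i)
        where
          rel′ : sum (λ i → μ i * r i) * a zero + lsum (λ i → μ i * a (suc i)) ≈ 0#
          rel′ = begin
            sum (λ i → μ i * r i) * a zero + lsum (λ i → μ i * a (suc i))
              ≈⟨ +-comm _ _ ⟩
            lsum (λ i → μ i * a (suc i)) + sum (λ i → μ i * r i) * a zero
              ≈⟨ +-cong (lsum≈sum (λ i → μ i * a (suc i))) (*-distribʳ-sum (a zero) (λ i → μ i * r i)) ⟩
            sum (λ i → μ i * a (suc i)) + sum (λ i → μ i * r i * a zero)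
              ≈⟨ ∑-distrib-+ (λ i → μ i * a (suc i)) (λ i → μ i * r i * a zero) ⟨
            sum (λ i → μ i * a (suc i) + μ i * r i * a zero)
              ≈⟨ sum-cong-≋ (λ i → trans (+-congˡ (*-assoc (μ i) (r i) (a zero)))
                                         (sym (distribˡ (μ i) (a (suc i)) (r i * a zero)))) ⟩
            sum (λ i → μ i * (a (suc i) + r i * a zero))
              ≈⟨ lsum≈sum (λ i → μ i * (a (suc i) + r i * a zero)) ⟨
            lsum (λ i → μ i * (a (suc i) + r i * a zero))
              ≈⟨ rel ⟩
            0# ∎

      lincomb-+* : ∀ {d} {b : Fin d → Carrier} {x y} r (cx cy : Fin d → Carrier) →
                   x ≈ lsum (λ j → cx j * b j) → y ≈ lsum (λ j → cy j * b j) →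
                   x + r * y ≈ lsum (λ j → (cx j + r * cy j) * b j)
      lincomb-+* {b = b} {x} {y} r cx cy x≈ y≈ = begin
        x + r * y
          ≈⟨ +-cong (trans x≈ (lsum≈sum (λ j → cx j * b j)))
                    (*-congˡ (trans y≈ (lsum≈sum (λ j → cy j * b j)))) ⟩
        sum (λ j → cx j * b j) + r * sum (λ j → cy j * b j)
          ≈⟨ +-congˡ (*-distribˡ-sum r (λ j → cy j * b j)) ⟩
        sum (λ j → cx j * b j) + sum (λ j → r * (cy j * b j))
          ≈⟨ ∑-distrib-+ (λ j → cx j * b j) (λ j → r * (cy j * b j)) ⟨
        sum (λ j → cx j * b j + r * (cy j * b j))
          ≈⟨ sum-cong-≋ (λ j → trans (+-congˡ (sym (*-assoc r (cy j) (b j))))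
                                     (sym (distribʳ (b j) (cx j) (r * cy j)))) ⟩
        sum (λ j → (cx j + r * cy j) * b j)
          ≈⟨ lsum≈sum (λ j → (cx j + r * cy j) * b j) ⟨
        lsum (λ j → (cx j + r * cy j) * b j) ∎

      inSpan-removeAt : ∀ {d} {b : Fin (suc d) → Carrier} {x} k (c : Fin (suc d) → Carrier) →
                        (∀ j → F (c j)) → x ≈ lsum (λ j → c j * b j) → c k ≈ 0# →
                        InSpan (removeAt b k) x
      inSpan-removeAt {b = b} {x} k c c∈F x≈ cₖ≈0 = removeAt c k , c∈F ∘ punchIn k , (begin
        x                                              ≈⟨ trans x≈ (lsum≈sum (λ j → c j * b j)) ⟩
        sum (λ j → c j * b j)                          ≈⟨ sum-remove {i = k} (λ j → c j * b j) ⟩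
        c k * b k + sum (removeAt (λ j → c j * b j) k) ≈⟨ +-congʳ (trans (*-congʳ cₖ≈0) (zeroˡ (b k))) ⟩
        0# + sum (removeAt (λ j → c j * b j) k)        ≈⟨ +-identityˡ _ ⟩
        sum (removeAt (λ j → c j * b j) k)             ≈⟨ lsum≈sum (removeAt (λ j → c j * b j) k) ⟨
        lsum (λ j → removeAt c k j * removeAt b k j)   ∎)

      -- Gaussian elimination of the k-th coordinate, pivoting on the k-th coefficient of a₀.
      eliminate : ∀ {d} {b : Fin (suc d) → Carrier} {a : Fin (suc (suc d)) → Carrier} →
                  (a∈span : ∀ j → InSpan b (a j)) → ∀ k → ¬ proj₁ (a∈span zero) k ≈ 0# →
                  ∃[ r ] ((∀ i → F (r i)) × (∀ i → InSpan (removeAt b k) (a (suc i) + r i * a zero)))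
      eliminate {b = b} {a} a∈span k pivot≉0 = r , r∈F , reduced
        where
          coeff : ∀ j → Fin _ → Carrier
          coeff j = proj₁ (a∈span j)
          coeff∈F : ∀ j m → F (coeff j m)
          coeff∈F j = proj₁ (proj₂ (a∈span j))
          a≈ : ∀ j → a j ≈ lsum (λ m → coeff j m * b m)
          a≈ j = proj₂ (proj₂ (a∈span j))
          p' = proj₁ (inverse (coeff zero k) pivot≉0)
          pp'≈1 = proj₂ (inverse (coeff zero k) pivot≉0)
          r : Fin _ → Carrier
          r i = - (coeff (suc i) k * p')
          r∈F : ∀ i → F (r i)
          r∈F i = F-neg (F-* (coeff∈F (suc i) k) (F-inverse (coeff∈F zero k) pp'≈1))
          reduced : ∀ i → InSpan (removeAt b k) (a (suc i) + r i * a zero)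
          reduced i =
            inSpan-removeAt {b = b} k (λ m → coeff (suc i) m + r i * coeff zero m)
              (λ m → F-+ (coeff∈F (suc i) m) (F-* (r∈F i) (coeff∈F zero m)))
              (lincomb-+* {b = b} (r i) (coeff (suc i)) (coeff zero) (a≈ (suc i)) (a≈ zero))
              (x+-[xp']p≈0 pp'≈1 (coeff (suc i) k))

      relation⇒inSpan : ∀ {d} {a : Fin d → Carrier} {w} (c : Fin (suc d) → Carrier) →
                        (∀ j → F (c j)) → ¬ c zero ≈ 0# →
                        lsum (λ j → c j * (w ∷ a) j) ≈ 0# → InSpan a w
      relation⇒inSpan {a = a} {w} c c∈F c₀≉0 rel =
        (λ j → - c₀' * c (suc j)) ,
        (λ j → F-* (F-neg (F-inverse (c∈F zero) c₀c₀'≈1)) (c∈F (suc j))) ,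
        sym (begin
          lsum (λ j → - c₀' * c (suc j) * a j)   ≈⟨ lsum≈sum (λ j → - c₀' * c (suc j) * a j) ⟩
          sum (λ j → - c₀' * c (suc j) * a j)    ≈⟨ sum-cong-≋ (λ j → *-assoc (- c₀') (c (suc j)) (a j)) ⟩
          sum (λ j → - c₀' * (c (suc j) * a j))  ≈⟨ *-distribˡ-sum (- c₀') (λ j → c (suc j) * a j) ⟨
          - c₀' * sum (λ j → c (suc j) * a j)    ≈⟨ *-congˡ (lsum≈sum (λ j → c (suc j) * a j)) ⟨
          - c₀' * lsum (λ j → c (suc j) * a j)   ≈⟨ *-congˡ (inverseʳ-unique _ _ rel) ⟩
          - c₀' * - (c zero * w)                 ≈⟨ -‿distribʳ-* (- c₀') _ ⟨
          - (- c₀' * (c zero * w))               ≈⟨ -‿cong (-‿distribˡ-* c₀' _) ⟨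
          - (- (c₀' * (c zero * w)))             ≈⟨ ⁻¹-involutive _ ⟩
          c₀' * (c zero * w)                     ≈⟨ *-cancelˡ-by-inverse (trans (*-comm c₀' _) c₀c₀'≈1) w ⟩
          w                                      ∎)
        where
          c₀' = proj₁ (inverse (c zero) c₀≉0)
          c₀c₀'≈1 = proj₂ (inverse (c zero) c₀≉0)

      IndependentIn : (Carrier → Set L) → ℕ → Set L
      IndependentIn W d = Σ (Fin d → Carrier) λ a → (∀ j → W (a j)) × Independent a

      InI⇒independentIn : ∀ {S T : Carrier → Set L} {i ξ} → S Respects _≈_ →
                          InI F i S T ξ → IndependentIn (Multipliers S T ξ) i
      InI⇒independentIn S-resp (a , a∈T , ia , ξ∈a⁻¹S) =
        a , (λ j → a∈T j , InInvScale⇒scaled S-resp (ξ∈a⁻¹S j)) , ia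

      independentIn⇒InI : ∀ {S T : Carrier → Set L} {i ξ} →
                          IndependentIn (Multipliers S T ξ) i → InI F i S T ξ
      independentIn⇒InI (a , a∈M , ia) =
        a , proj₁ ∘ a∈M , ia , λ j → scaled⇒InInvScale (independent⇒nonzero {a = a} ia j) (proj₂ (a∈M j))

      hasDim⇒graph : ∀ {W d ξ} → HasDim W d → HasDim₂ (Graph ξ W) d
      hasDim⇒graph {W} {ξ = ξ} (b , b∈W , ib , spans) =
        graph ∘ b , (λ j → b∈W j , refl) , independent , graph-spans
        where
          graph : Carrier → R²
          graph t = t * ξ , t
          independent : Independent₂ (graph ∘ b)
          independent c c∈F (_ , Σ≈0) =
            ib c c∈F (trans (sym (proj₂ (lsum₂-components c (graph ∘ b)))) Σ≈0)
          graph-spans : ∀ u → Graph ξ W u → V2.InSpan F (graph ∘ b) u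
          graph-spans (s , t) (t∈W , s≈tξ) with spans t t∈W
          ... | c , c∈F , t≈ =
            c , c∈F ,
            trans s≈tξ (trans (*-congʳ t≈) (trans (sym (lsum-*ʳ-assoc c b ξ))
                                                  (sym (proj₁ (lsum₂-components c (graph ∘ b)))))) ,
            trans t≈ (sym (proj₂ (lsum₂-components c (graph ∘ b))))

      graph⇒hasDim : ∀ {W d ξ} → HasDim₂ (Graph ξ W) d → HasDim W d
      graph⇒hasDim {W} {ξ = ξ} (β , β∈G , iβ , spans) =
        proj₂ ∘ β , proj₁ ∘ β∈G , independent , graph-spans
        where
          independent : Independent (proj₂ ∘ β)
          independent c c∈F Σ≈0 = iβ c c∈F (first , trans (proj₂ (lsum₂-components c β)) Σ≈0)
            where
              first = begin
                proj₁ (lsum₂ (λ j → c j ·₂ β j))        ≈⟨ proj₁ (lsum₂-components c β) ⟩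
                lsum (λ j → c j * proj₁ (β j))          ≈⟨ lsum-cong (λ j → *-congˡ (proj₂ (β∈G j))) ⟩
                lsum (λ j → c j * (proj₂ (β j) * ξ))    ≈⟨ lsum-*ʳ-assoc c (proj₂ ∘ β) ξ ⟩
                lsum (λ j → c j * proj₂ (β j)) * ξ      ≈⟨ *-congʳ Σ≈0 ⟩
                0# * ξ                                  ≈⟨ zeroˡ ξ ⟩
                0#                                      ∎
          graph-spans : ∀ t → W t → InSpan (proj₂ ∘ β) t
          graph-spans t t∈W with spans (t * ξ , t) (t∈W , refl)
          ... | c , c∈F , _ , t≈ = c , c∈F , trans t≈ (proj₂ (lsum₂-components c β))

      hasDim₂-resp : ∀ {P Q : R² → Set L} {d} → (∀ {u} → P u → Q u) → (∀ {u} → Q u → P u) →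
                     HasDim₂ P d → HasDim₂ Q d
      hasDim₂-resp P⊆Q Q⊆P (b , b∈P , ib , spans) = b , P⊆Q ∘ b∈P , ib , λ u → spans u ∘ Q⊆P

      weight⇒hasDim : ∀ {S T : Carrier → Set L} {v ξ d} → S Respects _≈_ → SamePoint v (ξ , 1#) →
                      HasWeight F (S ×ˢ T) v d → HasDim (Multipliers S T ξ) d
      weight⇒hasDim {S} {T} S-resp v∼ξ =
        graph⇒hasDim ∘ hasDim₂-resp (meet⇒graph {S} {T} S-resp v∼ξ) (graph⇒meet {S} {T} S-resp v∼ξ)

      hasDim⇒weight : ∀ {S T : Carrier → Set L} {v ξ d} → S Respects _≈_ → SamePoint v (ξ , 1#) →
                      HasDim (Multipliers S T ξ) d → HasWeight F (S ×ˢ T) v d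
      hasDim⇒weight {S} {T} S-resp v∼ξ =
        hasDim₂-resp (graph⇒meet {S} {T} S-resp v∼ξ) (meet⇒graph {S} {T} S-resp v∼ξ) ∘ hasDim⇒graph

      InI⇒InL : ∀ {S T : Carrier → Set L} {v ξ i} → S Respects _≈_ → SamePoint v (ξ , 1#) →
                InI F (suc i) S T ξ → InL (S ×ˢ T) v
      InI⇒InL {S} {T} S-resp v∼ξ (a , a∈T , ia , ξ∈a⁻¹S) =
        Meet-nonzero⇒InL
          (graph⇒meet {S} {T} S-resp v∼ξ ((a∈T zero , InInvScale⇒scaled S-resp (ξ∈a⁻¹S zero)) , refl))
          (independent⇒nonzero {a = a} ia zero ∘ proj₂)

      module WithDecidableEquality (_≟_ : Decidable _≈_) where

        ¬independent-in-span : ∀ {d} (b : Fin d → Carrier) (a : Fin (suc d) → Carrier) →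
                               (∀ j → InSpan b (a j)) → ¬ Independent a
        ¬independent-in-span {zero} b a a∈span ia =
          independent⇒nonzero {a = a} ia zero (proj₂ (proj₂ (a∈span zero)))
        ¬independent-in-span {suc d} b a a∈span ia with any? (λ k → ¬? (proj₁ (a∈span zero) k ≟ 0#))
        ... | yes (k , pivot≉0) =
          let r , r∈F , reduced = eliminate {b = b} {a} a∈span k pivot≉0
          in ¬independent-in-span (removeAt b k) _ reduced (independent-shear {a = a} r∈F ia)
        ... | no no-pivot = independent⇒nonzero {a = a} ia zero a₀≈0
          where
            c₀ = proj₁ (a∈span zero)
            c₀≈0 : ∀ k → c₀ k ≈ 0#
            c₀≈0 k = decidable-stable (c₀ k ≟ 0#) (λ c₀ₖ≉0 → no-pivot (k , c₀ₖ≉0))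
            a₀≈0 : a zero ≈ 0#
            a₀≈0 = trans (proj₂ (proj₂ (a∈span zero)))
                         (lsum-zero (λ k → trans (*-congʳ (c₀≈0 k)) (zeroˡ (b k))))

        independent-∷ : ∀ {d} {a : Fin d → Carrier} {w} →
                        Independent a → ¬ InSpan a w → Independent (w ∷ a)
        independent-∷ {a = a} {w} ia w∉span c c∈F rel with c zero ≟ 0#
        ... | no c₀≉0 = ⊥-elim (w∉span (relation⇒inSpan c c∈F c₀≉0 rel))
        ... | yes c₀≈0 = λ { zero → c₀≈0 ; (suc j) → ia (c ∘ suc) (c∈F ∘ suc) tail≈0 j }
          where
            tail≈0 : lsum (λ j → c (suc j) * a j) ≈ 0#
            tail≈0 = begin
              lsum (λ j → c (suc j) * a j)          ≈⟨ +-identityˡ _ ⟨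
              0# + lsum (λ j → c (suc j) * a j)     ≈⟨ +-congʳ (trans (*-congʳ c₀≈0) (zeroˡ w)) ⟨
              c zero * w + lsum (λ j → c (suc j) * a j) ≈⟨ rel ⟩
              0#                                    ∎

        hasDim⇒maximal : ∀ {W d} → HasDim W d → IndependentIn W d × ¬ IndependentIn W (suc d)
        hasDim⇒maximal (b , b∈W , ib , spans) =
          (b , b∈W , ib) ,
          λ (a , a∈W , ia) → ¬independent-in-span b a (λ j → spans (a j) (a∈W j)) ia

        weight⇒InI : ∀ {S T : Carrier → Set L} {v ξ i} → S Respects _≈_ → SamePoint v (ξ , 1#) →
                     HasWeight F (S ×ˢ T) v i → InI F i S T ξ × ¬ InI F (suc i) S T ξ
        weight⇒InI {S} {T} S-resp v∼ξ weight =
          let independent , maximal = hasDim⇒maximal (weight⇒hasDim S-resp v∼ξ weight)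
          in independentIn⇒InI {S} {T} independent , maximal ∘ InI⇒independentIn {S} {T} S-resp

        module OverFiniteSubfield {q} (F-finite : HasCard _≈_ F q) where

          inSpan? : ∀ {d} (a : Fin d → Carrier) w → Dec (InSpan a w)
          inSpan? {zero} a w with w ≟ 0#
          ... | yes w≈0 = yes ((λ ()) , (λ ()) , w≈0)
          ... | no  w≉0 = no λ (_ , _ , w≈0) → w≉0 w≈0
          inSpan? {suc d} a w with any? (λ i → inSpan? (a ∘ suc) (- (e i * a zero) + w))
            where e = proj₁ F-finite
          ... | yes (i , c , c∈F , rest≈) =
            yes (e i ∷ c , all-∷ {P = F} (e∈F i) c∈F , trans (sym (\\-leftDividesˡ _ w)) (+-congˡ rest≈))
            where
              e = proj₁ F-finite
              e∈F = proj₁ (proj₂ F-finite)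
          ... | no none = no λ (c , c∈F , w≈) →
            let i , c₀≈eᵢ = proj₂ (proj₂ (proj₂ F-finite)) (c zero) (c∈F zero)
            in none (i , c ∘ suc , c∈F ∘ suc ,
                     trans (+-congʳ (-‿cong (*-congʳ (sym c₀≈eᵢ))))
                           (trans (+-congˡ w≈) (\\-leftDividesʳ _ _)))

          maximal⇒hasDim : ∀ {W d} → IndependentIn W d → ¬ IndependentIn W (suc d) → HasDim W d
          maximal⇒hasDim {W} (a , a∈W , ia) maximal =
            a , a∈W , ia ,
            λ w w∈W → decidable-stable (inSpan? a w)
                        (λ w∉span → maximal (w ∷ a , all-∷ {P = W} w∈W a∈W , independent-∷ ia w∉span))

          InI⇒weight : ∀ {S T : Carrier → Set L} {v ξ i} → S Respects _≈_ → SamePoint v (ξ , 1#) →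
                       InI F i S T ξ → ¬ InI F (suc i) S T ξ → HasWeight F (S ×ˢ T) v i
          InI⇒weight {S} {T} S-resp v∼ξ ξ∈Iᵢ ξ∉Iᵢ₊₁ =
            hasDim⇒weight S-resp v∼ξ
              (maximal⇒hasDim (InI⇒independentIn {S} {T} S-resp ξ∈Iᵢ)
                              (ξ∉Iᵢ₊₁ ∘ independentIn⇒InI {S} {T}))

corollary3p3 : {c ℓ : Level} (K : CommutativeRing c ℓ) →
    let open CommutativeRing K
        open FieldDefs K
    in IsField →
       (F : Carrier → Set L) → IsSubfield F →
       (q n k r : ℕ) → IsPrimePower q → 1 ≤ n → 1 ≤ k → 1 ≤ r →
       HasCard _≈_ F q → HasCard _≈_ (λ _ → ⊤) (q ^ n) →
       (S T : Carrier → Set L) →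
       V1.IsSubspace F S → V1.HasDim F S (k ∸ r) →
       V1.IsSubspace F T → V1.HasDim F T r →
       r ≤ k ∸ r →
       (i : ℕ) → 1 ≤ i →
       (v : R²) → ¬ (v ≈₂ 0₂) →
       ((InL (S ×ˢ T) v × HasWeight F (S ×ˢ T) v i × ¬ SamePoint v (1# , 0#)) →
          ∃[ ξ ] (InI F i S T ξ × ¬ InI F (suc i) S T ξ × SamePoint v (ξ , 1#)))
       × ((∃[ ξ ] (InI F i S T ξ × ¬ InI F (suc i) S T ξ × SamePoint v (ξ , 1#))) →
          (InL (S ×ˢ T) v × HasWeight F (S ×ˢ T) v i × ¬ SamePoint v (1# , 0#)))
corollary3p3 K isField F isSubfield _ _ _ _ _ _ _ _ F-finite K-finite S T S-subspace _ _ _ _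
             (suc i) (s≤s z≤n) v v≉0 =
  (λ (_ , weight , v≁∞) →
     let ξ , v∼ξ = ¬∞⇒affine v≉0 v≁∞
         ξ∈Iᵢ , ξ∉Iᵢ₊₁ = weight⇒InI (proj₁ S-subspace) v∼ξ weight
     in ξ , ξ∈Iᵢ , ξ∉Iᵢ₊₁ , v∼ξ) ,
  (λ (ξ , ξ∈Iᵢ , ξ∉Iᵢ₊₁ , v∼ξ) →
     InI⇒InL (proj₁ S-subspace) v∼ξ ξ∈Iᵢ ,
     InI⇒weight (proj₁ S-subspace) v∼ξ ξ∈Iᵢ ξ∉Iᵢ₊₁ ,
     affine⇒¬∞ v∼ξ)
  where
    open ProjectiveLine K
    open OverField isField
    open OverSubfield F isSubfield
    open WithDecidableEquality (finite⇒≈-decidable K-finite)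
    open OverFiniteSubfield F-finite
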